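{- Let $\mathsf{M}$ be a matroid without loops and coloops whose rank is $1$ or whose corank is $1$. Then $T_{\mathsf{M}}(2,0)\cdot T_{\mathsf{M}}(0,2)\geq T_{\mathsf{M}}(1,1)^2$.
   Context: $T_{\mathsf{M}}(x,y)$ denotes the Tutte polynomial of $\mathsf{M}$. The corank of a matroid on ground set $E$ of rank $k$ is $|E|-k$. -}

module Defs where

open import Data.Nat using (ℕ; zero; suc; _≤_; _∸_; _<_)
open import Data.Integer using (ℤ; +_; _-_; _*_; _^_)
import Data.Integer as ℤ
open import Data.Fin using (Fin)
open import Data.Fin.Subset using (_─_)
open import Data.Fin.Subset using (Subset; _⊆_; _∪_; _∩_; ⊥; ⊤; ∣_∣; ⁅_⁆; inside; outside)
open import Data.List using (List; []; _∷_; map; _++_)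
open import Data.Vec using (_∷_; [])
open import Relation.Binary.PropositionalEquality using (_≡_)

record Matroid (n : ℕ) : Set where
  field
    rk         : Subset n → ℕ
    rk-bounded : ∀ A → rk A ≤ ∣ A ∣
    rk-mono    : ∀ {A B} → A ⊆ B → rk A ≤ rk B
    rk-submod  : ∀ A B → rk (A ∪ B) Data.Nat.+ rk (A ∩ B) ≤ rk A Data.Nat.+ rk B
open Matroid public

rank : ∀ {n} → Matroid n → ℕ
rank M = rk M ⊤

corank : ∀ {n} → Matroid n → ℕ
corank {n} M = n ∸ rank M

IsLoop : ∀ {n} → Matroid n → Fin n → Set
IsLoop M e = rk M ⁅ e ⁆ ≡ 0

IsColoop : ∀ {n} → Matroid n → Fin n → Set
IsColoop M e = rk M (⊤ ─ ⁅ e ⁆) < rank M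

allSubsets : ∀ n → List (Subset n)
allSubsets zero = [] ∷ []
allSubsets (suc n) = map (inside ∷_) (allSubsets n) ++ map (outside ∷_) (allSubsets n)

sumℤ : List ℤ → ℤ
sumℤ [] = + 0
sumℤ (x ∷ xs) = x ℤ.+ sumℤ xs

-- Tutte polynomial evaluated at integers x, y:
-- T_M(x,y) = Σ_{A ⊆ E} (x-1)^{r(E)-r(A)} (y-1)^{|A|-r(A)}   (with 0^0 = 1)
tutte : ∀ {n} → Matroid n → ℤ → ℤ → ℤ
tutte {n} M x y =
  sumℤ (map (λ A → ((x - + 1) ^ (rank M ∸ rk M A)) * ((y - + 1) ^ (∣ A ∣ ∸ rk M A)))
            (allSubsets n))

-- A loopless rank-one matroid is the uniform matroid U₁,ₙ: a k-subset has rank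
-- 1 ⊓ k.  In a coloopless corank-one matroid every set missing an element is
-- independent, so it is the dual of U₁,ₙ and its Tutte polynomial is that of
-- U₁,ₙ with x and y swapped.  For U₁,ₙ one finds T(1,1) = n, T(2,0) = 2 and
-- T(0,2) = 2ⁿ − 2, and the absence of coloops forces n ≥ 2, where
-- n² ≤ 2(2ⁿ − 2).
module Submission where

open import Defs
open import Data.Nat using (ℕ)
open import Data.Integer using (+_; _*_; _≤_)
open import Data.Sum using (_⊎_)
open import Relation.Nullary using (¬_)
open import Relation.Binary.PropositionalEquality using (_≡_)

open import Data.Nat as ℕ using (zero; suc; _∸_; _⊓_; z≤n; s≤s)
import Data.Nat.Properties as ℕ
open import Data.Nat.Tactic.RingSolver using (solve-∀)
open import Data.Integer as ℤ using (ℤ; 0ℤ; 1ℤ; -1ℤ; _+_; _-_; _^_; +≤+)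
import Data.Integer.Properties as ℤ
open import Data.Fin using (Fin)
import Data.Fin as Fin
open import Data.Fin.Subset
  using (Subset; inside; outside; ∣_∣; ∁; ⊤; ⁅_⁆; _─_; _∪_; _⊆_; _∈_; _∉_; Nonempty)
open import Data.Fin.Subset.Properties
  using (∣⊥∣≡0; ∣⊤∣≡n; ∣p∣≤n; ∣p∣≡n⇒p≡⊤; ∣∁p∣≡n∸∣p∣; ∈⊤; ⊆⊤; _∈?_; nonempty?; Empty-unique;
         x∈⁅y⁆⇒x≡y; x∈∁p⇒x∉p; x∈p∧x∉q⇒x∈p─q; x∈p∧x≢y⇒x∈p-y; x∈p⇒∣p-x∣<∣p∣;
         p⊆p∪q; q⊆p∪q; x∈p∪q⁻; p⊆q⇒∣p∣≤∣q∣)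
open import Data.List using (List; []; _∷_; map; _++_)
import Data.List.Properties as List
open import Data.Vec using ([]; _∷_)
open import Data.Product using (_,_)
open import Data.Sum using (inj₁; inj₂)
open import Function using (_∘_; flip)
open import Relation.Nullary using (yes; no; contradiction)
open import Relation.Binary.PropositionalEquality
  using (refl; sym; trans; cong; cong₂; subst; subst₂; module ≡-Reasoning)

sumℤ-++ : ∀ xs ys → sumℤ (xs ++ ys) ≡ sumℤ xs + sumℤ ys
sumℤ-++ []       ys = sym (ℤ.+-identityˡ (sumℤ ys))
sumℤ-++ (x ∷ xs) ys = trans (cong (λ s → x + s) (sumℤ-++ xs ys)) (sym (ℤ.+-assoc x (sumℤ xs) (sumℤ ys)))

sumℤ-allSubsets-suc : ∀ n (f : Subset (suc n) → ℤ) →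
  sumℤ (map f (allSubsets (suc n))) ≡
  sumℤ (map (f ∘ (inside ∷_)) (allSubsets n)) + sumℤ (map (f ∘ (outside ∷_)) (allSubsets n))
sumℤ-allSubsets-suc n f = begin
  sumℤ (map f (map (inside ∷_) L ++ map (outside ∷_) L))
    ≡⟨ cong sumℤ (List.map-++ f (map (inside ∷_) L) _) ⟩
  sumℤ (map f (map (inside ∷_) L) ++ map f (map (outside ∷_) L))
    ≡⟨ sumℤ-++ (map f (map (inside ∷_) L)) _ ⟩
  sumℤ (map f (map (inside ∷_) L)) + sumℤ (map f (map (outside ∷_) L))
    ≡⟨ cong₂ (λ xs ys → sumℤ xs + sumℤ ys) (List.map-∘ L) (List.map-∘ L) ⟨
  sumℤ (map (f ∘ (inside ∷_)) L) + sumℤ (map (f ∘ (outside ∷_)) L) ∎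
  where
  open ≡-Reasoning
  L : List (Subset n)
  L = allSubsets n

-- Σₖ (n choose k) · h k, unfolded along Pascal's rule.
binomialSum : ℕ → (ℕ → ℤ) → ℤ
binomialSum zero    h = h 0
binomialSum (suc n) h = binomialSum n (h ∘ suc) + binomialSum n h

sumℤ-allSubsets-∣∣ : ∀ n (h : ℕ → ℤ) → sumℤ (map (h ∘ ∣_∣) (allSubsets n)) ≡ binomialSum n h
sumℤ-allSubsets-∣∣ zero    h = ℤ.+-identityʳ (h 0)
sumℤ-allSubsets-∣∣ (suc n) h = trans (sumℤ-allSubsets-suc n (h ∘ ∣_∣))
  (cong₂ _+_ (sumℤ-allSubsets-∣∣ n (h ∘ suc)) (sumℤ-allSubsets-∣∣ n h))

sumℤ-allSubsets-∣∁∣ : ∀ n (h : ℕ → ℤ) → sumℤ (map (h ∘ ∣_∣ ∘ ∁) (allSubsets n)) ≡ binomialSum n h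
sumℤ-allSubsets-∣∁∣ zero    h = ℤ.+-identityʳ (h 0)
sumℤ-allSubsets-∣∁∣ (suc n) h = trans (sumℤ-allSubsets-suc n (h ∘ ∣_∣ ∘ ∁))
  (trans (cong₂ _+_ (sumℤ-allSubsets-∣∁∣ n h) (sumℤ-allSubsets-∣∁∣ n (h ∘ suc)))
         (ℤ.+-comm (binomialSum n h) _))

binomialSum-cong : ∀ n {g h : ℕ → ℤ} → (∀ k → g k ≡ h k) → binomialSum n g ≡ binomialSum n h
binomialSum-cong zero    g≗h = g≗h 0
binomialSum-cong (suc n) g≗h = cong₂ _+_ (binomialSum-cong n (g≗h ∘ suc)) (binomialSum-cong n g≗h)

binomialSum-*ˡ : ∀ n c (h : ℕ → ℤ) → binomialSum n (λ k → c * h k) ≡ c * binomialSum n h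
binomialSum-*ˡ zero    c h = refl
binomialSum-*ˡ (suc n) c h = trans (cong₂ _+_ (binomialSum-*ˡ n c (h ∘ suc)) (binomialSum-*ˡ n c h))
  (sym (ℤ.*-distribˡ-+ c (binomialSum n (h ∘ suc)) _))

+-double : ∀ a → + a + + a ≡ + (2 ℕ.* a)
+-double a = trans (sym (ℤ.pos-+ a a)) (cong (λ b → + (a ℕ.+ b)) (sym (ℕ.+-identityʳ a)))

binomialSum-1 : ∀ n → binomialSum n (λ _ → + 1) ≡ + (2 ℕ.^ n)
binomialSum-1 zero    = refl
binomialSum-1 (suc n) = trans (cong₂ _+_ (binomialSum-1 n) (binomialSum-1 n)) (+-double (2 ℕ.^ n))

binomialSum-0^ : ∀ n → binomialSum n (0ℤ ^_) ≡ + 1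
binomialSum-0^ zero    = refl
binomialSum-0^ (suc n) = cong₂ _+_ (binomialSum-*ˡ n (+ 0) (0ℤ ^_)) (binomialSum-0^ n)

binomialSum-[-1]^ : ∀ n → binomialSum (suc n) (-1ℤ ^_) ≡ + 0
binomialSum-[-1]^ n = begin
  binomialSum n (λ k → -1ℤ * -1ℤ ^ k) + binomialSum n (-1ℤ ^_)
    ≡⟨ cong (_+ binomialSum n (-1ℤ ^_)) (binomialSum-*ˡ n -1ℤ (-1ℤ ^_)) ⟩
  -1ℤ * binomialSum n (-1ℤ ^_) + binomialSum n (-1ℤ ^_)
    ≡⟨ cong (_+ binomialSum n (-1ℤ ^_)) (ℤ.-1*i≡-i (binomialSum n (-1ℤ ^_))) ⟩
  ℤ.- binomialSum n (-1ℤ ^_) + binomialSum n (-1ℤ ^_)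
    ≡⟨ ℤ.+-inverseˡ (binomialSum n (-1ℤ ^_)) ⟩
  + 0 ∎
  where open ≡-Reasoning

-- The summand of a k-subset of U₁,ₙ, which has rank 1 ⊓ k.
rankOneSummand : ℤ → ℤ → ℕ → ℤ
rankOneSummand x y zero    = x - + 1
rankOneSummand x y (suc k) = (y - + 1) ^ k

rankOneSummand-correct : ∀ x y k →
  (x - + 1) ^ (1 ∸ 1 ⊓ k) * (y - + 1) ^ (k ∸ 1 ⊓ k) ≡ rankOneSummand x y k
rankOneSummand-correct x y zero    = trans (ℤ.*-identityʳ _) (ℤ.^-identityʳ (x - + 1))
rankOneSummand-correct x y (suc k) = ℤ.*-identityˡ ((y - + 1) ^ k)

tutteU₁ : ℕ → ℤ → ℤ → ℤ
tutteU₁ n x y = binomialSum n (rankOneSummand x y)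

tutteU₁-1-1 : ∀ n → tutteU₁ n (+ 1) (+ 1) ≡ + n
tutteU₁-1-1 zero    = refl
tutteU₁-1-1 (suc n) = cong₂ _+_ (binomialSum-0^ n) (tutteU₁-1-1 n)

tutteU₁-2-0 : ∀ n → tutteU₁ (suc n) (+ 2) (+ 0) ≡ + 2
tutteU₁-2-0 zero    = refl
tutteU₁-2-0 (suc n) = cong₂ _+_ (binomialSum-[-1]^ n) (tutteU₁-2-0 n)

tutteU₁-0-2 : ∀ n → tutteU₁ n (+ 0) (+ 2) ≡ + (2 ℕ.^ n) - + 2
tutteU₁-0-2 zero    = refl
tutteU₁-0-2 (suc n) = begin
  binomialSum n (1ℤ ^_) + tutteU₁ n (+ 0) (+ 2)
    ≡⟨ cong₂ _+_ (trans (binomialSum-cong n ℤ.^-zeroˡ) (binomialSum-1 n)) (tutteU₁-0-2 n) ⟩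
  + (2 ℕ.^ n) + (+ (2 ℕ.^ n) - + 2)
    ≡⟨ ℤ.+-assoc (+ (2 ℕ.^ n)) (+ (2 ℕ.^ n)) (ℤ.- + 2) ⟨
  + (2 ℕ.^ n) + + (2 ℕ.^ n) - + 2
    ≡⟨ cong (_- + 2) (+-double (2 ℕ.^ n)) ⟩
  + (2 ℕ.^ suc n) - + 2 ∎
  where open ≡-Reasoning

[2+k]²+4≤2^[3+k] : ∀ k → (2 ℕ.+ k) ℕ.* (2 ℕ.+ k) ℕ.+ 4 ℕ.≤ 2 ℕ.^ (3 ℕ.+ k)
[2+k]²+4≤2^[3+k] zero    = ℕ.≤-refl
[2+k]²+4≤2^[3+k] (suc k) = begin
  (3 ℕ.+ k) ℕ.* (3 ℕ.+ k) ℕ.+ 4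
    ≤⟨ ℕ.m≤m+n _ (k ℕ.* k ℕ.+ 2 ℕ.* k ℕ.+ 3) ⟩
  (3 ℕ.+ k) ℕ.* (3 ℕ.+ k) ℕ.+ 4 ℕ.+ (k ℕ.* k ℕ.+ 2 ℕ.* k ℕ.+ 3)
    ≡⟨ expand k ⟩
  2 ℕ.* ((2 ℕ.+ k) ℕ.* (2 ℕ.+ k) ℕ.+ 4)
    ≤⟨ ℕ.*-monoʳ-≤ 2 ([2+k]²+4≤2^[3+k] k) ⟩
  2 ℕ.^ (4 ℕ.+ k) ∎
  where
  open ℕ.≤-Reasoning
  expand : ∀ k → (3 ℕ.+ k) ℕ.* (3 ℕ.+ k) ℕ.+ 4 ℕ.+ (k ℕ.* k ℕ.+ 2 ℕ.* k ℕ.+ 3)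
               ≡ 2 ℕ.* ((2 ℕ.+ k) ℕ.* (2 ℕ.+ k) ℕ.+ 4)
  expand = solve-∀

MerinoWelsh : (ℤ → ℤ → ℤ) → Set
MerinoWelsh T = T (+ 1) (+ 1) * T (+ 1) (+ 1) ≤ T (+ 2) (+ 0) * T (+ 0) (+ 2)

MerinoWelsh-resp : ∀ {T U : ℤ → ℤ → ℤ} → (∀ x y → T x y ≡ U x y) → MerinoWelsh U → MerinoWelsh T
MerinoWelsh-resp T≗U = subst₂ _≤_ (sym (cong₂ _*_ (T≗U _ _) (T≗U _ _))) (sym (cong₂ _*_ (T≗U _ _) (T≗U _ _)))

MerinoWelsh-flip : ∀ {T : ℤ → ℤ → ℤ} → MerinoWelsh T → MerinoWelsh (flip T)
MerinoWelsh-flip {T} = subst (T (+ 1) (+ 1) * T (+ 1) (+ 1) ≤_) (ℤ.*-comm (T (+ 2) (+ 0)) _)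

tutteU₁-MerinoWelsh : ∀ {n} → 2 ℕ.≤ n → MerinoWelsh (tutteU₁ n)
tutteU₁-MerinoWelsh {suc (suc k)} (s≤s (s≤s z≤n))
  rewrite tutteU₁-1-1 (2 ℕ.+ k) | tutteU₁-2-0 (suc k) | tutteU₁-0-2 (2 ℕ.+ k) = begin
  + n * + n                        ≡⟨ ℤ.pos-* n n ⟨
  + (n ℕ.* n)                      ≤⟨ +≤+ n²≤2[2ⁿ∸2] ⟩
  + (2 ℕ.* (2 ℕ.^ n ∸ 2))          ≡⟨ ℤ.pos-* 2 (2 ℕ.^ n ∸ 2) ⟩
  + 2 * + (2 ℕ.^ n ∸ 2)            ≡⟨ cong (+ 2 *_) 2ⁿ-2≡2ⁿ∸2 ⟨
  + 2 * (+ (2 ℕ.^ n) - + 2)        ∎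
  where
  open ℤ.≤-Reasoning
  n : ℕ
  n = 2 ℕ.+ k
  2ⁿ-2≡2ⁿ∸2 : + (2 ℕ.^ n) - + 2 ≡ + (2 ℕ.^ n ∸ 2)
  2ⁿ-2≡2ⁿ∸2 = trans (ℤ.m-n≡m⊖n (2 ℕ.^ n) 2) (ℤ.⊖-≥ (ℕ.^-monoʳ-≤ 2 {1} {n} (s≤s z≤n)))
  n²≤2[2ⁿ∸2] : n ℕ.* n ℕ.≤ 2 ℕ.* (2 ℕ.^ n ∸ 2)
  n²≤2[2ⁿ∸2] = subst (n ℕ.* n ℕ.≤_) (sym (ℕ.*-distribˡ-∸ 2 (2 ℕ.^ n) 2))
                 (ℕ.m+n≤o⇒m≤o∸n (n ℕ.* n) ([2+k]²+4≤2^[3+k] k))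

Loopless : ∀ {n} → Matroid n → Set
Loopless M = ∀ e → ¬ IsLoop M e

Coloopless : ∀ {n} → Matroid n → Set
Coloopless M = ∀ e → ¬ IsColoop M e

-- Equivalently rk M A ≡ ∣ A ∣, by rk-bounded.
Independent : ∀ {n} → Matroid n → Subset n → Set
Independent M A = ∣ A ∣ ℕ.≤ rk M A

∣p∣≡1+k⇒Nonempty : ∀ {n k} (p : Subset n) → ∣ p ∣ ≡ suc k → Nonempty p
∣p∣≡1+k⇒Nonempty {n} p ∣p∣≡1+k with nonempty? p
... | yes nonempty = nonempty
... | no  empty    = contradiction (trans (sym (trans (cong ∣_∣ (Empty-unique empty)) (∣⊥∣≡0 n))) ∣p∣≡1+k) ℕ.0≢1+n

∣p∣+∣∁p∣≡n : ∀ {n} (p : Subset n) → ∣ p ∣ ℕ.+ ∣ ∁ p ∣ ≡ n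
∣p∣+∣∁p∣≡n p = trans (cong (∣ p ∣ ℕ.+_) (∣∁p∣≡n∸∣p∣ p)) (ℕ.m+[n∸m]≡n (∣p∣≤n p))

∣p∣+∣q─p∣≡∣p∪q∣ : ∀ {n} (p q : Subset n) → ∣ p ∣ ℕ.+ ∣ q ─ p ∣ ≡ ∣ p ∪ q ∣
∣p∣+∣q─p∣≡∣p∪q∣ []            []            = refl
∣p∣+∣q─p∣≡∣p∪q∣ (inside  ∷ p) (_       ∷ q) = cong suc (∣p∣+∣q─p∣≡∣p∪q∣ p q)
∣p∣+∣q─p∣≡∣p∪q∣ (outside ∷ p) (inside  ∷ q) = trans (ℕ.+-suc ∣ p ∣ _) (cong suc (∣p∣+∣q─p∣≡∣p∪q∣ p q))
∣p∣+∣q─p∣≡∣p∪q∣ (outside ∷ p) (outside ∷ q) = ∣p∣+∣q─p∣≡∣p∪q∣ p q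

q⊆p∪[q─p] : ∀ {n} (p q : Subset n) → q ⊆ p ∪ (q ─ p)
q⊆p∪[q─p] p q {x} x∈q with x ∈? p
... | yes x∈p = p⊆p∪q (q ─ p) x∈p
... | no  x∉p = q⊆p∪q p (q ─ p) (x∈p∧x∉q⇒x∈p─q x∈q x∉p)

p⊆q⇒p∪q⊆q : ∀ {n} {p q : Subset n} → p ⊆ q → p ∪ q ⊆ q
p⊆q⇒p∪q⊆q {p = p} {q} p⊆q x∈p∪q with x∈p∪q⁻ p q x∈p∪q
... | inj₁ x∈p = p⊆q x∈p
... | inj₂ x∈q = x∈q

∣⊤─⁅x⁆∣<n : ∀ {n} (x : Fin n) → ∣ ⊤ ─ ⁅ x ⁆ ∣ ℕ.< n
∣⊤─⁅x⁆∣<n {n} x = subst (∣ ⊤ ─ ⁅ x ⁆ ∣ ℕ.<_) (∣⊤∣≡n n) (x∈p⇒∣p-x∣<∣p∣ {x = x} {p = ⊤ {n}} ∈⊤)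

module _ {n} (M : Matroid n) where

  rank≤n : rank M ℕ.≤ n
  rank≤n = subst (rank M ℕ.≤_) (∣⊤∣≡n n) (rk-bounded M ⊤)

  rank<n : ∀ e → ¬ IsColoop M e → rank M ℕ.< n
  rank<n e e-notColoop = ℕ.≤-<-trans (ℕ.≮⇒≥ e-notColoop)
    (ℕ.≤-<-trans (rk-bounded M (⊤ ─ ⁅ e ⁆)) (∣⊤─⁅x⁆∣<n e))

  rk-nonempty : Loopless M → ∀ {A} → Nonempty A → 1 ℕ.≤ rk M A
  rk-nonempty loopless {A} (e , e∈A) = ℕ.≤-trans (ℕ.n≢0⇒n>0 (loopless e)) (rk-mono M ⁅e⁆⊆A)
    where
    ⁅e⁆⊆A : ⁅ e ⁆ ⊆ A
    ⁅e⁆⊆A x∈⁅e⁆ = subst (_∈ A) (sym (x∈⁅y⁆⇒x≡y e x∈⁅e⁆)) e∈A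

  rk-∪-≤ : ∀ A B → rk M (A ∪ B) ℕ.≤ rk M A ℕ.+ ∣ B ∣
  rk-∪-≤ A B = ℕ.≤-trans (ℕ.m≤m+n _ _)
    (ℕ.≤-trans (rk-submod M A B) (ℕ.+-monoʳ-≤ (rk M A) (rk-bounded M B)))

  Independent-⊆ : ∀ {A B} → A ⊆ B → Independent M B → Independent M A
  Independent-⊆ {A} {B} A⊆B B-indep = ℕ.+-cancelʳ-≤ ∣ B ─ A ∣ ∣ A ∣ (rk M A) (begin
    ∣ A ∣ ℕ.+ ∣ B ─ A ∣       ≡⟨ ∣p∣+∣q─p∣≡∣p∪q∣ A B ⟩
    ∣ A ∪ B ∣                 ≤⟨ p⊆q⇒∣p∣≤∣q∣ (p⊆q⇒p∪q⊆q A⊆B) ⟩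
    ∣ B ∣                     ≤⟨ B-indep ⟩
    rk M B                    ≤⟨ rk-mono M (q⊆p∪[q─p] A B) ⟩
    rk M (A ∪ (B ─ A))        ≤⟨ rk-∪-≤ A (B ─ A) ⟩
    rk M A ℕ.+ ∣ B ─ A ∣      ∎)
    where open ℕ.≤-Reasoning

  tutteSummand : ℤ → ℤ → Subset n → ℤ
  tutteSummand x y A = (x - + 1) ^ (rank M ∸ rk M A) * (y - + 1) ^ (∣ A ∣ ∸ rk M A)

  tutte≡sumℤ : ∀ x y {f : Subset n → ℤ} → (∀ A → tutteSummand x y A ≡ f A) →
    tutte M x y ≡ sumℤ (map f (allSubsets n))
  tutte≡sumℤ x y summand≗f = cong sumℤ (List.map-cong summand≗f (allSubsets n))

module RankOne {n} (M : Matroid n) (loopless : Loopless M) (rank≡1 : rank M ≡ 1) where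

  rk≡1⊓∣∣ : ∀ A → rk M A ≡ 1 ⊓ ∣ A ∣
  rk≡1⊓∣∣ A with ∣ A ∣ in ∣A∣≡
  ... | zero  = ℕ.n≤0⇒n≡0 (subst (rk M A ℕ.≤_) ∣A∣≡ (rk-bounded M A))
  ... | suc _ = ℕ.≤-antisym (subst (rk M A ℕ.≤_) rank≡1 (rk-mono M ⊆⊤))
                            (rk-nonempty M loopless (∣p∣≡1+k⇒Nonempty A ∣A∣≡))

  tutte-rankOne : ∀ x y → tutte M x y ≡ tutteU₁ n x y
  tutte-rankOne x y = trans (tutte≡sumℤ M x y summand) (sumℤ-allSubsets-∣∣ n (rankOneSummand x y))
    where
    summand : ∀ A → tutteSummand M x y A ≡ rankOneSummand x y ∣ A ∣
    summand A = trans (cong₂ (λ r s → (x - + 1) ^ (r ∸ s) * (y - + 1) ^ (∣ A ∣ ∸ s)) rank≡1 (rk≡1⊓∣∣ A))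
                      (rankOneSummand-correct x y ∣ A ∣)

rank≡1⇒2≤n : ∀ {n} (M : Matroid n) → Coloopless M → rank M ≡ 1 → 2 ℕ.≤ n
rank≡1⇒2≤n {zero}  M _          rank≡1 = contradiction (subst (ℕ._≤ 0) rank≡1 (rank≤n M)) λ ()
rank≡1⇒2≤n {suc _} M coloopless rank≡1 = subst (ℕ._< _) rank≡1 (rank<n M Fin.zero (coloopless Fin.zero))

module CorankOne {m} (M : Matroid (suc m)) (coloopless : Coloopless M) (rank≡m : rank M ≡ m) where

  Independent-∉ : ∀ {A e} → e ∉ A → Independent M A
  Independent-∉ {A} {e} e∉A = Independent-⊆ M A⊆E-e E-e-indep
    where
    E-e-indep : Independent M (⊤ ─ ⁅ e ⁆)
    E-e-indep = ℕ.≤-trans (ℕ.≤-pred (∣⊤─⁅x⁆∣<n e))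
                          (subst (ℕ._≤ rk M (⊤ ─ ⁅ e ⁆)) rank≡m (ℕ.≮⇒≥ (coloopless e)))
    A⊆E-e : A ⊆ ⊤ ─ ⁅ e ⁆
    A⊆E-e x∈A = x∈p∧x≢y⇒x∈p-y ∈⊤ λ { refl → e∉A x∈A }

  tutteSummand-corankOne : ∀ x y A → tutteSummand M x y A ≡ rankOneSummand y x ∣ ∁ A ∣
  tutteSummand-corankOne x y A with ∣ ∁ A ∣ in ∣∁A∣≡ | ∣p∣+∣∁p∣≡n A
  ... | zero  | ∣A∣+0≡1+m = begin
    tutteSummand M x y A
      ≡⟨ cong (tutteSummand M x y) (∣p∣≡n⇒p≡⊤ {p = A} (trans (sym (ℕ.+-identityʳ ∣ A ∣)) ∣A∣+0≡1+m)) ⟩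
    (x - + 1) ^ (rank M ∸ rank M) * (y - + 1) ^ (∣ ⊤ {suc m} ∣ ∸ rank M)
      ≡⟨ cong₂ (λ r a → (x - + 1) ^ (r ∸ r) * (y - + 1) ^ (a ∸ r)) rank≡m (∣⊤∣≡n (suc m)) ⟩
    (x - + 1) ^ (m ∸ m) * (y - + 1) ^ (suc m ∸ m)
      ≡⟨ cong₂ (λ a b → (x - + 1) ^ a * (y - + 1) ^ b) (ℕ.n∸n≡0 m) (ℕ.m+n∸n≡m 1 m) ⟩
    + 1 * (y - + 1) ^ 1
      ≡⟨ trans (ℤ.*-identityˡ _) (ℤ.^-identityʳ (y - + 1)) ⟩
    y - + 1 ∎
    where open ≡-Reasoning
  ... | suc d | ∣A∣+1+d≡1+m = begin
    (x - + 1) ^ (rank M ∸ rk M A) * (y - + 1) ^ (∣ A ∣ ∸ rk M A)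
      ≡⟨ cong₂ (λ r s → (x - + 1) ^ (r ∸ s) * (y - + 1) ^ (∣ A ∣ ∸ s)) rank≡m rk≡∣A∣ ⟩
    (x - + 1) ^ (m ∸ ∣ A ∣) * (y - + 1) ^ (∣ A ∣ ∸ ∣ A ∣)
      ≡⟨ cong₂ (λ a b → (x - + 1) ^ a * (y - + 1) ^ b) m∸∣A∣≡d (ℕ.n∸n≡0 ∣ A ∣) ⟩
    (x - + 1) ^ d * + 1
      ≡⟨ ℤ.*-identityʳ _ ⟩
    (x - + 1) ^ d ∎
    where
    open ≡-Reasoning
    rk≡∣A∣ : rk M A ≡ ∣ A ∣
    rk≡∣A∣ with ∣p∣≡1+k⇒Nonempty (∁ A) ∣∁A∣≡
    ... | e , e∈∁A = ℕ.≤-antisym (rk-bounded M A) (Independent-∉ (x∈∁p⇒x∉p e∈∁A))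
    m∸∣A∣≡d : m ∸ ∣ A ∣ ≡ d
    m∸∣A∣≡d = trans (cong (_∸ ∣ A ∣) (ℕ.suc-injective (trans (sym ∣A∣+1+d≡1+m) (ℕ.+-suc ∣ A ∣ d))))
                    (ℕ.m+n∸m≡n ∣ A ∣ d)

  tutte-corankOne : ∀ x y → tutte M x y ≡ tutteU₁ (suc m) y x
  tutte-corankOne x y = trans (tutte≡sumℤ M x y (tutteSummand-corankOne x y))
                              (sumℤ-allSubsets-∣∁∣ (suc m) (rankOneSummand y x))

corank≡1⇒rank≡n : ∀ {n} (M : Matroid (suc n)) → corank M ≡ 1 → rank M ≡ n
corank≡1⇒rank≡n M corank≡1 =
  ℕ.suc-injective (trans (cong (ℕ._+ rank M) (sym corank≡1)) (ℕ.m∸n+n≡m (rank≤n M)))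

lemma2p6 : ∀ {n} (M : Matroid n) →
    (∀ e → ¬ IsLoop M e) → (∀ e → ¬ IsColoop M e) →
    (rank M ≡ 1 ⊎ corank M ≡ 1) →
    tutte M (+ 1) (+ 1) * tutte M (+ 1) (+ 1) ≤ tutte M (+ 2) (+ 0) * tutte M (+ 0) (+ 2)
lemma2p6 M loopless coloopless (inj₁ rank≡1) =
  MerinoWelsh-resp tutte-rankOne (tutteU₁-MerinoWelsh (rank≡1⇒2≤n M coloopless rank≡1))
  where open RankOne M loopless rank≡1
lemma2p6 {zero} M _ _ (inj₂ corank≡1) = contradiction (trans (sym (ℕ.0∸n≡0 (rank M))) corank≡1) λ ()
lemma2p6 {suc n} M loopless coloopless (inj₂ corank≡1) =
  MerinoWelsh-resp tutte-corankOne (MerinoWelsh-flip {tutteU₁ (suc n)} (tutteU₁-MerinoWelsh (s≤s 1≤n)))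
  where
  rank≡n : rank M ≡ n
  rank≡n = corank≡1⇒rank≡n M corank≡1
  open CorankOne M coloopless rank≡n
  1≤n : 1 ℕ.≤ n
  1≤n = subst (1 ℕ.≤_) rank≡n (rk-nonempty M loopless (Fin.zero , ∈⊤))
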